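{- Let $F$ be a field, $n\ge 0$, and $p \in V_n$. There exists $q\in V_n$ such that $p(x^2) = x^n q(x+x^{ -1})$ if and only if $p\in W_n$. Moreover, in this case such $q$ is unique and $q \in U_n$.
   Context: $V_n$ denotes the $F$-vector space of polynomials in $F[x]$ of degree at most $n$. $W_n = \{c_0x^n + c_1x^{n-1}+\dots+c_n \in V_n : c_i = c_{n-i} \text{ for all } 0\le i\le n\}$ and $U_n = \{c_0x^n + c_1x^{n-1}+\dots+c_n\in V_n : c_i = 0 \text{ for all odd } i\}$ (coefficients indexed relative to $V_n$). A polynomial $p\in V_n$ is said to be represented by $q\in V_n$ if $p(x^2)=x^n q(x+x^{ -1})$. -}

module Defs where

open import Level using (Level; _⊔_; suc)
open import Data.Nat as ℕ using (ℕ; zero; _∸_)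
open import Data.Nat.Base using (_%_)
open import Relation.Binary.PropositionalEquality using (_≡_)
open import Data.Fin using (Fin; toℕ; opposite)
open import Data.List as List using (List; []; _∷_)
open import Data.Product using (Σ; _×_; _,_; ∃)
open import Relation.Nullary using (¬_)
open import Algebra.Bundles using (CommutativeRing)

record Field (c ℓ : Level) : Set (Level.suc (c ⊔ ℓ)) where
  field
    commutativeRing : CommutativeRing c ℓ
  open CommutativeRing commutativeRing public
  field
    1≉0     : ¬ (1# ≈ 0#)
    inverse : ∀ x → ¬ (x ≈ 0#) → Σ Carrier λ y → x * y ≈ 1#

module FieldPolys {c ℓ : Level} (F : Field c ℓ) where
  open Field F

  -- Polynomials in F[x] as coefficient lists, ascending degree:
  -- the list a₀ ∷ a₁ ∷ … represents a₀ + a₁ x + a₂ x² + …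
  Poly : Set c
  Poly = List Carrier

  coeff : Poly → ℕ → Carrier
  coeff []       _       = 0#
  coeff (a ∷ as) zero    = a
  coeff (a ∷ as) (ℕ.suc k) = coeff as k

  _≈P_ : Poly → Poly → Set ℓ
  P ≈P Q = ∀ k → coeff P k ≈ coeff Q k

  _⊕_ : Poly → Poly → Poly
  []       ⊕ Q        = Q
  (a ∷ P)  ⊕ []       = a ∷ P
  (a ∷ P)  ⊕ (b ∷ Q)  = (a + b) ∷ (P ⊕ Q)

  scale : Carrier → Poly → Poly
  scale a = List.map (a *_)

  shiftX : Poly → Poly
  shiftX P = 0# ∷ P

  _⊗_ : Poly → Poly → Poly
  []      ⊗ Q = []
  (a ∷ P) ⊗ Q = scale a Q ⊕ shiftX (P ⊗ Q)

  xPow : ℕ → Poly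
  xPow zero      = 1# ∷ []
  xPow (ℕ.suc k) = shiftX (xPow k)

  constP : Carrier → Poly
  constP a = a ∷ []

  -- Laurent polynomials F[x, x⁻¹]: a pair (k , P) stands for x^{-k} · P(x).
  Laurent : Set c
  Laurent = ℕ × Poly

  _≈L_ : Laurent → Laurent → Set ℓ
  (k , P) ≈L (l , Q) = (xPow l ⊗ P) ≈P (xPow k ⊗ Q)

  _⊕L_ : Laurent → Laurent → Laurent
  (k , P) ⊕L (l , Q) = (k ℕ.+ l , (xPow l ⊗ P) ⊕ (xPow k ⊗ Q))

  _⊗L_ : Laurent → Laurent → Laurent
  (k , P) ⊗L (l , Q) = (k ℕ.+ l , P ⊗ Q)

  fromPoly : Poly → Laurent
  fromPoly P = (0 , P)

  evalL : Poly → Laurent → Laurent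
  evalL []      t = fromPoly []
  evalL (a ∷ P) t = fromPoly (constP a) ⊕L (t ⊗L evalL P t)

  evalP : Poly → Poly → Poly
  evalP []      Q = []
  evalP (a ∷ P) Q = constP a ⊕ (Q ⊗ evalP P Q)

  -- x + x⁻¹ as a Laurent polynomial: x⁻¹ · (1 + x²)
  x+x⁻¹ : Laurent
  x+x⁻¹ = (1 , 1# ∷ 0# ∷ 1# ∷ [])

  x² : Poly
  x² = xPow 2

  -- Elements of V_n: c₀ xⁿ + c₁ xⁿ⁻¹ + … + cₙ, given by the coefficient
  -- family i ↦ cᵢ (index relative to V_n, i.e. cᵢ is the coefficient of x^{n-i}).
  V : ℕ → Set c
  V n = Fin (ℕ.suc n) → Carrier

  toPoly : ∀ n → V n → Poly
  toPoly n cs = List.tabulate (λ k → cs (opposite k))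

  InW : ∀ n → V n → Set ℓ
  InW n cs = ∀ i → cs i ≈ cs (opposite i)

  InU : ∀ n → V n → Set ℓ
  InU n cs = ∀ i → toℕ i % 2 ≡ 1 → cs i ≈ 0#

  Represents : ∀ n → V n → V n → Set ℓ
  Represents n p q =
    fromPoly (evalP (toPoly n p) x²) ≈L (fromPoly (xPow n) ⊗L evalL (toPoly n q) x+x⁻¹)

{-# OPTIONS --safe #-}
-- Multiplying by x, the condition reads x·p(x²) = x^{n+1} q(x + x⁻¹). By Horner's rule
-- x^{k+1} c(x + x⁻¹) = c₀ x^{k+1} + (1 + x²) · x^k c′(x + x⁻¹) for c(y) = c₀ + y c′(y), so by
-- induction on k the polynomials x^k c(x + x⁻¹) with deg c < k are exactly the palindromes of
-- degree 2k with vanishing end coefficients, and c is unique: below the middle degree one can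
-- cancel the factor 1 + x² to recover c′, and then the middle coefficient determines c₀.
-- Since x·p(x²) is such a palindrome (for k = n + 1) exactly when p is palindromic, this gives
-- existence iff p ∈ W_n, and uniqueness. Finally, the term q_a x^{n+1-a} (1 + x²)^a only has
-- degrees of the parity of n + 1 - a, while x·p(x²) has no terms of even degree; running the
-- uniqueness argument on even degrees only gives q_a = 0 whenever n - a is odd, i.e. q ∈ U_n.
module Submission where

open import Defs
open import Level using (Level)
open import Algebra.Bundles using (AbelianGroup)
open import Data.Empty using (⊥-elim)
open import Data.Fin.Base as Fin using (Fin; toℕ; opposite; fromℕ<)
import Data.Fin.Properties as Finₚ
open import Data.List.Base using ([]; _∷_; length; tabulate)
open import Data.List.Properties using (length-tabulate)
open import Data.Nat.Base as Nat using (ℕ; zero; suc; _∸_; _⊓_; _≤_; _<_; z≤n; s≤s; parity; ⌊_/2⌋; _%_)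
import Data.Nat.Properties as ℕₚ
open import Data.Parity.Base as ℙ using (0ℙ; 1ℙ)
import Data.Parity.Properties as ℙₚ
open import Data.Product using (Σ; _×_; _,_; proj₁; proj₂; ∃)
open import Data.Sum using (inj₁; inj₂)
open import Function.Bundles using (_⇔_; mk⇔; module Equivalence)
open import Relation.Nullary using (¬_; yes; no)
open import Function.Base using (_∘_)
import Relation.Binary.PropositionalEquality as ≡
open ≡ using (_≡_; _≢_)
open import Algebra.Properties.CommutativeSemigroup ℕₚ.+-commutativeSemigroup using (interchange)

module Arithmetic where
  open Nat using (_+_)

  double-suc : ∀ k → suc k + suc k ≡ suc (suc (k + k))
  double-suc k = ≡.cong suc (ℕₚ.+-suc k k)

  parity-double : ∀ a → parity (a + a) ≡ 0ℙ
  parity-double a = ≡.trans (ℙₚ.+-homo-+ a a) (ℙₚ.p+p≡0ℙ (parity a))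

  parity-double+1 : ∀ a → parity (suc (a + a)) ≡ 1ℙ
  parity-double+1 a = ≡.trans (ℙₚ.+-homo-+ 1 (a + a)) (≡.cong (1ℙ ℙ.+_) (parity-double a))

  parity-double≢double+1 : ∀ a b → parity (a + a) ≢ parity (suc (b + b))
  parity-double≢double+1 a b eq = ℙₚ.p≢p⁻¹ 0ℙ
    (≡.trans (≡.sym (parity-double a)) (≡.trans eq (parity-double+1 b)))

  +≡double⇒parity≡ : ∀ j l k → j + l ≡ k + k → parity j ≡ parity l
  +≡double⇒parity≡ j l k e = ℙₚ.+-cancelʳ-≡ (parity l) (parity j) (parity l) (begin
    parity j ℙ.+ parity l  ≡⟨ ℙₚ.+-homo-+ j l ⟨
    parity (j + l)         ≡⟨ ≡.cong parity e ⟩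
    parity (k + k)         ≡⟨ parity-double k ⟩
    0ℙ                     ≡⟨ ℙₚ.p+p≡0ℙ (parity l) ⟨
    parity l ℙ.+ parity l  ∎)
    where open ≡.≡-Reasoning

  data Halves : ℕ → Set where
    even : ∀ a → Halves (a + a)
    odd  : ∀ a → Halves (suc (a + a))

  halves : ∀ j → Halves j
  halves zero = even 0
  halves (suc j) with halves j
  ... | even a = odd a
  ... | odd a  = ≡.subst Halves (double-suc a) (even (suc a))

  doubles-+ : ∀ a b {n} → a + b ≡ n → (a + a) + (b + b) ≡ n + n
  doubles-+ a b e = ≡.trans (interchange a a b b) (≡.cong₂ _+_ e e)

  doubles-+⁻¹ : ∀ a b {n} → (a + a) + (b + b) ≡ n + n → a + b ≡ n
  doubles-+⁻¹ a b {n} e = begin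
    a + b                      ≡⟨ ℕₚ.n≡⌊n+n/2⌋ (a + b) ⟩
    ⌊ (a + b) + (a + b) /2⌋    ≡⟨ ≡.cong ⌊_/2⌋ (interchange a a b b) ⟨
    ⌊ (a + a) + (b + b) /2⌋    ≡⟨ ≡.cong ⌊_/2⌋ e ⟩
    ⌊ n + n /2⌋                ≡⟨ ℕₚ.n≡⌊n+n/2⌋ n ⟨
    n                          ∎
    where open ≡.≡-Reasoning

  ⊓-∸-mirror : ∀ {j l m} → j + l ≡ m → j ⊓ (m ∸ j) ≡ l ⊓ (m ∸ l)
  ⊓-∸-mirror {j} {l} {m} e = begin
    j ⊓ (m ∸ j)  ≡⟨ ≡.cong (j ⊓_) (≡.trans (≡.cong (_∸ j) (≡.sym e)) (ℕₚ.m+n∸m≡n j l)) ⟩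
    j ⊓ l        ≡⟨ ℕₚ.⊓-comm j l ⟩
    l ⊓ j        ≡⟨ ≡.cong (l ⊓_) (≡.trans (≡.cong (_∸ l) (≡.sym e)) (ℕₚ.m+n∸n≡m j l)) ⟨
    l ⊓ (m ∸ l)  ∎
    where open ≡.≡-Reasoning

  m%2≡1⇒parity[1+m]≡0ℙ : ∀ m → m % 2 ≡ 1 → parity (suc m) ≡ 0ℙ
  m%2≡1⇒parity[1+m]≡0ℙ (suc zero)    _ = ≡.refl
  m%2≡1⇒parity[1+m]≡0ℙ (suc (suc m)) e = m%2≡1⇒parity[1+m]≡0ℙ m e

  toℕ-opposite-+ : ∀ {n} (i : Fin (suc n)) → toℕ (opposite i) + toℕ i ≡ n
  toℕ-opposite-+ i =
    ≡.trans (≡.cong (_+ toℕ i) (Finₚ.opposite-prop i)) (ℕₚ.m∸n+n≡m (ℕₚ.≤-pred (Finₚ.toℕ<n i)))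

  toℕ-opposite-+-suc : ∀ {n} (i : Fin (suc n)) → toℕ (opposite i) + suc (toℕ i) ≡ suc n
  toℕ-opposite-+-suc i = ≡.trans (ℕₚ.+-suc _ (toℕ i)) (≡.cong suc (toℕ-opposite-+ i))

  toℕ-opposite-fromℕ< : ∀ {a b n} (a<n+1 : a < suc n) → a + b ≡ n → toℕ (opposite (fromℕ< a<n+1)) ≡ b
  toℕ-opposite-fromℕ< {a} {b} {n} a<n+1 a+b≡n = begin
    toℕ (opposite (fromℕ< a<n+1))  ≡⟨ Finₚ.opposite-prop (fromℕ< a<n+1) ⟩
    n ∸ toℕ (fromℕ< a<n+1)         ≡⟨ ≡.cong (n ∸_) (Finₚ.toℕ-fromℕ< a<n+1) ⟩
    n ∸ a                          ≡⟨ ≡.cong (_∸ a) a+b≡n ⟨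
    a + b ∸ a                      ≡⟨ ℕₚ.m+n∸m≡n a b ⟩
    b                              ∎
    where open ≡.≡-Reasoning

module Sequences {a ℓ} (G : AbelianGroup a ℓ) where
  open AbelianGroup G
  open import Algebra.Properties.AbelianGroup G using (∙-cancelʳ; //-rightDividesˡ)
  open import Relation.Binary.Reasoning.Setoid setoid
  open Nat using (_+_)
  open Arithmetic

  Seq : Set a
  Seq = ℕ → Carrier

  infix 4 _≋_
  _≋_ : Seq → Seq → Set ℓ
  f ≋ g = ∀ j → f j ≈ g j

  shift : ℕ → Seq → Seq
  shift zero    f j       = f j
  shift (suc l) f zero    = ε
  shift (suc l) f (suc j) = shift l f j

  monomial : ℕ → Carrier → Seq
  monomial zero    x zero    = x
  monomial zero    x (suc j) = ε
  monomial (suc m) x zero    = ε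
  monomial (suc m) x (suc j) = monomial m x j

  mul1+x² : Seq → Seq
  mul1+x² f j = f j ∙ shift 2 f j

  dilate : Seq → Seq
  dilate f zero          = f zero
  dilate f (suc zero)    = ε
  dilate f (suc (suc j)) = dilate (f ∘ suc) j

  -- x^k · Σ_{i<k} c_i (x + x⁻¹)^i, by Horner's rule
  substX+X⁻¹ : ℕ → Seq → Seq
  substX+X⁻¹ zero    c j = ε
  substX+X⁻¹ (suc k) c j = monomial (suc k) (c 0) j ∙ mul1+x² (substX+X⁻¹ k (c ∘ suc)) j

  Palindromic : ℕ → Seq → Set ℓ
  Palindromic m f = ∀ j l → j + l ≡ m → f j ≈ f l

  VanishesFrom : ℕ → Seq → Set ℓ
  VanishesFrom m f = ∀ j → m ≤ j → f j ≈ ε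

  -- x^k φ(x) for a Laurent polynomial φ with φ(x⁻¹) = φ(x) and all exponents in (-k, k)
  Symmetric : ℕ → Seq → Set ℓ
  Symmetric k f = Palindromic (k + k) f × VanishesFrom (k + k) f

  palindromic-resp-≋ : ∀ {m f g} → f ≋ g → Palindromic m g → Palindromic m f
  palindromic-resp-≋ f≋g P j l e = trans (f≋g j) (trans (P j l e) (sym (f≋g l)))

  symmetric⇒vanishes-at-0 : ∀ {k f} → Symmetric k f → f 0 ≈ ε
  symmetric⇒vanishes-at-0 {k} (P , Z) = trans (P 0 (k + k) ≡.refl) (Z (k + k) ℕₚ.≤-refl)

  shift-cong : ∀ l {f g} → f ≋ g → shift l f ≋ shift l g
  shift-cong zero    f≋g j       = f≋g j
  shift-cong (suc l) f≋g zero    = refl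
  shift-cong (suc l) f≋g (suc j) = shift-cong l f≋g j

  shift-+ : ∀ l f j → shift l f (l + j) ≡ f j
  shift-+ zero    f j = ≡.refl
  shift-+ (suc l) f j = shift-+ l f j

  shift-suc : ∀ l f j → shift (suc l) f j ≡ shift l (shift 1 f) j
  shift-suc zero    f j       = ≡.refl
  shift-suc (suc l) f zero    = ≡.refl
  shift-suc (suc l) f (suc j) = shift-suc l f j

  shift-1∘shift : ∀ l f j → shift 1 (shift l f) j ≡ shift (suc l) f j
  shift-1∘shift l f zero    = ≡.refl
  shift-1∘shift l f (suc j) = ≡.refl

  shift-cancel : ∀ l {f g} → shift l f ≋ shift l g → f ≋ g
  shift-cancel l {f} {g} eq j = begin
    f j               ≡⟨ shift-+ l f j ⟨
    shift l f (l + j) ≈⟨ eq (l + j) ⟩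
    shift l g (l + j) ≡⟨ shift-+ l g j ⟩
    g j               ∎

  shift-ε : ∀ l j → shift l (λ _ → ε) j ≡ ε
  shift-ε zero    j       = ≡.refl
  shift-ε (suc l) zero    = ≡.refl
  shift-ε (suc l) (suc j) = shift-ε l j

  monomial-diagonal : ∀ m x → monomial m x m ≡ x
  monomial-diagonal zero    x = ≡.refl
  monomial-diagonal (suc m) x = monomial-diagonal m x

  monomial-off : ∀ m x j → j ≢ m → monomial m x j ≡ ε
  monomial-off zero    x zero    j≢m = ⊥-elim (j≢m ≡.refl)
  monomial-off zero    x (suc j) j≢m = ≡.refl
  monomial-off (suc m) x zero    j≢m = ≡.refl
  monomial-off (suc m) x (suc j) j≢m = monomial-off m x j (j≢m ∘ ≡.cong suc)

  monomial-ε : ∀ m j → monomial m ε j ≡ ε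
  monomial-ε zero    zero    = ≡.refl
  monomial-ε zero    (suc j) = ≡.refl
  monomial-ε (suc m) zero    = ≡.refl
  monomial-ε (suc m) (suc j) = monomial-ε m j

  monomial-cong : ∀ m {x y} → x ≈ y → ∀ j → monomial m x j ≈ monomial m y j
  monomial-cong zero    x≈y zero    = x≈y
  monomial-cong zero    x≈y (suc j) = refl
  monomial-cong (suc m) x≈y zero    = refl
  monomial-cong (suc m) x≈y (suc j) = monomial-cong m x≈y j

  monomial-palindromic : ∀ m x → Palindromic (m + m) (monomial m x)
  monomial-palindromic m x j l e with j ℕₚ.≟ m
  ... | yes ≡.refl = reflexive (≡.trans (monomial-diagonal m x) (≡.sym (≡.trans
                       (≡.cong (monomial m x) (ℕₚ.+-cancelˡ-≡ m l m e)) (monomial-diagonal m x))))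
  ... | no j≢m = reflexive (≡.trans (monomial-off m x j j≢m) (≡.sym (monomial-off m x l l≢m)))
    where
    l≢m : l ≢ m
    l≢m ≡.refl = j≢m (ℕₚ.+-cancelʳ-≡ m j m e)

  mul1+x²-cong : ∀ {f g} → f ≋ g → mul1+x² f ≋ mul1+x² g
  mul1+x²-cong f≋g j = ∙-cong (f≋g j) (shift-cong 2 f≋g j)

  mul1+x²-local : ∀ {f g} j → (∀ i → i ≤ j → parity i ≡ parity j → f i ≈ g i) →
                  mul1+x² f j ≈ mul1+x² g j
  mul1+x²-local zero          agree = ∙-cong (agree 0 z≤n ≡.refl) refl
  mul1+x²-local (suc zero)    agree = ∙-cong (agree 1 ℕₚ.≤-refl ≡.refl) refl
  mul1+x²-local (suc (suc j)) agree = ∙-cong (agree _ ℕₚ.≤-refl ≡.refl) (agree j (ℕₚ.m≤n+m j 2) ≡.refl)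

  mul1+x²-cancel : ∀ {f g} m π → (∀ j → j ≤ m → parity j ≡ π → mul1+x² f j ≈ mul1+x² g j) →
                   ∀ j → j ≤ m → parity j ≡ π → f j ≈ g j
  mul1+x²-cancel m π eq zero       j≤m πj = ∙-cancelʳ ε _ _ (eq 0 j≤m πj)
  mul1+x²-cancel m π eq (suc zero) j≤m πj = ∙-cancelʳ ε _ _ (eq 1 j≤m πj)
  mul1+x²-cancel {f} {g} m π eq (suc (suc j)) j≤m πj =
    ∙-cancelʳ (f j) _ _ (trans (eq _ j≤m πj) (∙-congˡ (sym fj≈gj)))
    where
    fj≈gj : f j ≈ g j
    fj≈gj = mul1+x²-cancel m π eq j (ℕₚ.≤-trans (ℕₚ.m≤n+m j 2) j≤m) πj

  mul1+x²-ε : ∀ j → mul1+x² (λ _ → ε) j ≈ ε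
  mul1+x²-ε j = trans (∙-congˡ (reflexive (shift-ε 2 j))) (identityʳ ε)

  mul1+x²-vanishes : ∀ {m f} → VanishesFrom m f → VanishesFrom (2 + m) (mul1+x² f)
  mul1+x²-vanishes Z zero          ()
  mul1+x²-vanishes Z (suc zero)    (s≤s ())
  mul1+x²-vanishes Z (suc (suc j)) (s≤s (s≤s m≤j)) =
    trans (∙-cong (Z _ (ℕₚ.m≤n⇒m≤1+n (ℕₚ.m≤n⇒m≤1+n m≤j))) (Z j m≤j)) (identityʳ ε)

  mul1+x²-palindromic : ∀ {m f} → Palindromic m f → VanishesFrom m f → Palindromic (2 + m) (mul1+x² f)
  mul1+x²-palindromic {m} {f} P Z j l e = begin
    f j ∙ shift 2 f j  ≈⟨ ∙-cong (reflect j l e) (sym (reflect l j (≡.trans (ℕₚ.+-comm l j) e))) ⟩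
    shift 2 f l ∙ f l  ≈⟨ comm _ _ ⟩
    f l ∙ shift 2 f l  ∎
    where
    reflect : ∀ j l → j + l ≡ 2 + m → f j ≈ shift 2 f l
    reflect j zero e =
      Z j (ℕₚ.≤-trans (ℕₚ.m≤n+m m 2) (ℕₚ.≤-reflexive (≡.trans (≡.sym e) (ℕₚ.+-identityʳ j))))
    reflect j (suc zero) e =
      Z j (ℕₚ.≤-trans (ℕₚ.n≤1+n m)
                      (ℕₚ.≤-reflexive (ℕₚ.suc-injective (≡.trans (≡.sym e) (ℕₚ.+-comm j 1)))))
    reflect j (suc (suc l)) e = P j l (ℕₚ.suc-injective (ℕₚ.suc-injective (≡.trans (≡.sym j+2+l) e)))
      where
      j+2+l : j + suc (suc l) ≡ suc (suc (j + l))
      j+2+l = ≡.trans (ℕₚ.+-suc j (suc l)) (≡.cong suc (ℕₚ.+-suc j l))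

  divide1+x² : Seq → Seq
  divide1+x² f zero          = f zero
  divide1+x² f (suc zero)    = f (suc zero)
  divide1+x² f (suc (suc j)) = f (suc (suc j)) - divide1+x² f j

  mul1+x²-divide1+x² : ∀ f → mul1+x² (divide1+x² f) ≋ f
  mul1+x²-divide1+x² f zero          = identityʳ _
  mul1+x²-divide1+x² f (suc zero)    = identityʳ _
  mul1+x²-divide1+x² f (suc (suc j)) = //-rightDividesˡ (divide1+x² f j) (f (suc (suc j)))

  mirror : ℕ → Seq → Seq
  mirror m h j = h (j ⊓ (m ∸ j))

  mirror-palindromic : ∀ m h → Palindromic m (mirror m h)
  mirror-palindromic m h j l e = reflexive (≡.cong h (⊓-∸-mirror e))

  mirror-vanishes : ∀ m h → h 0 ≈ ε → VanishesFrom m (mirror m h)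
  mirror-vanishes m h h0≈ε j m≤j =
    trans (reflexive (≡.cong h (≡.trans (≡.cong (j ⊓_) (ℕₚ.m≤n⇒m∸n≡0 m≤j)) (ℕₚ.⊓-zeroʳ j)))) h0≈ε

  mirror-below : ∀ m h j → j + j ≤ m → mirror m h j ≡ h j
  mirror-below m h j 2j≤m = ≡.cong h (ℕₚ.m≤n⇒m⊓n≡m (ℕₚ.m+n≤o⇒m≤o∸n j 2j≤m))

  substX+X⁻¹-cong : ∀ k {c d} → (∀ i → i < k → c i ≈ d i) → substX+X⁻¹ k c ≋ substX+X⁻¹ k d
  substX+X⁻¹-cong zero    c≈d j = refl
  substX+X⁻¹-cong (suc k) c≈d j =
    ∙-cong (monomial-cong (suc k) (c≈d 0 (s≤s z≤n)) j)
           (mul1+x²-cong (substX+X⁻¹-cong k (λ i i<k → c≈d (suc i) (s≤s i<k))) j)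

  substX+X⁻¹-ε : ∀ k j → substX+X⁻¹ k (λ _ → ε) j ≈ ε
  substX+X⁻¹-ε zero    j = refl
  substX+X⁻¹-ε (suc k) j = begin
    monomial (suc k) ε j ∙ mul1+x² (substX+X⁻¹ k (λ _ → ε)) j
      ≈⟨ ∙-cong (reflexive (monomial-ε (suc k) j)) (mul1+x²-cong (substX+X⁻¹-ε k) j) ⟩
    ε ∙ mul1+x² (λ _ → ε) j  ≈⟨ identityˡ _ ⟩
    mul1+x² (λ _ → ε) j      ≈⟨ mul1+x²-ε j ⟩
    ε                        ∎

  substX+X⁻¹-symmetric : ∀ k c → Symmetric k (substX+X⁻¹ k c)
  substX+X⁻¹-symmetric zero    c = (λ _ _ _ → refl) , (λ _ _ → refl)
  substX+X⁻¹-symmetric (suc k) c = palindromic , vanishes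
    where
    P = proj₁ (substX+X⁻¹-symmetric k (c ∘ suc))
    Z = proj₂ (substX+X⁻¹-symmetric k (c ∘ suc))

    palindromic : Palindromic (suc k + suc k) (substX+X⁻¹ (suc k) c)
    palindromic j l e = ∙-cong (monomial-palindromic (suc k) (c 0) j l e)
                               (mul1+x²-palindromic P Z j l (≡.trans e (double-suc k)))

    vanishes : VanishesFrom (suc k + suc k) (substX+X⁻¹ (suc k) c)
    vanishes j 2k+2≤j = trans (∙-cong (reflexive (monomial-off (suc k) (c 0) j j≢k+1))
                                      (mul1+x²-vanishes Z j 2+2k≤j))
                              (identityʳ ε)
      where
      j≢k+1 : j ≢ suc k
      j≢k+1 = ℕₚ.>⇒≢ (ℕₚ.<-≤-trans (ℕₚ.m<m+n (suc k) (s≤s z≤n)) 2k+2≤j)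
      2+2k≤j : 2 + (k + k) ≤ j
      2+2k≤j = ℕₚ.≤-trans (ℕₚ.≤-reflexive (≡.sym (double-suc k))) 2k+2≤j

  symmetric-agree-on-parity : ∀ k {f g} π → Symmetric k f → Symmetric k g →
                              (∀ j → j ≤ k → parity j ≡ π → f j ≈ g j) →
                              ∀ j → parity j ≡ π → f j ≈ g j
  symmetric-agree-on-parity k {f} {g} π (Pf , Zf) (Pg , Zg) low j πj with j ℕₚ.≤? k | k + k ℕₚ.≤? j
  ... | yes j≤k | _        = low j j≤k πj
  ... | no _    | yes 2k≤j = trans (Zf j 2k≤j) (sym (Zg j 2k≤j))
  ... | no j≰k  | no 2k≰j  = begin
    f j  ≈⟨ Pf j l j+l≡2k ⟩
    f l  ≈⟨ low l l≤k (≡.trans (≡.sym (+≡double⇒parity≡ j l k j+l≡2k)) πj) ⟩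
    g l  ≈⟨ Pg j l j+l≡2k ⟨
    g j  ∎
    where
    l = k + k ∸ j
    j+l≡2k : j + l ≡ k + k
    j+l≡2k = ℕₚ.m+[n∸m]≡n (ℕₚ.<⇒≤ (ℕₚ.≰⇒> 2k≰j))
    l≤k : l ≤ k
    l≤k = ℕₚ.+-cancelˡ-≤ k l k (ℕₚ.≤-trans (ℕₚ.+-monoˡ-≤ l (ℕₚ.≰⇒≥ j≰k)) (ℕₚ.≤-reflexive j+l≡2k))

  symmetric-agree : ∀ k {f g} → Symmetric k f → Symmetric k g → (∀ j → j ≤ k → f j ≈ g j) → f ≋ g
  symmetric-agree k Sf Sg low j =
    symmetric-agree-on-parity k (parity j) Sf Sg (λ i i≤k _ → low i i≤k) j ≡.refl

  substX+X⁻¹-suc-below : ∀ k c {j} → j ≤ k → substX+X⁻¹ (suc k) c j ≈ mul1+x² (substX+X⁻¹ k (c ∘ suc)) j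
  substX+X⁻¹-suc-below k c {j} j≤k =
    trans (∙-congʳ (reflexive (monomial-off (suc k) (c 0) j (ℕₚ.<⇒≢ (s≤s j≤k))))) (identityˡ _)

  substX+X⁻¹-tail : ∀ k c d π →
    (∀ j → parity j ≡ π → substX+X⁻¹ (suc k) c j ≈ substX+X⁻¹ (suc k) d j) →
    ∀ j → parity j ≡ π → substX+X⁻¹ k (c ∘ suc) j ≈ substX+X⁻¹ k (d ∘ suc) j
  substX+X⁻¹-tail k c d π eq =
    symmetric-agree-on-parity k π (substX+X⁻¹-symmetric k _) (substX+X⁻¹-symmetric k _)
      (mul1+x²-cancel k π below)
    where
    below : ∀ j → j ≤ k → parity j ≡ π →
            mul1+x² (substX+X⁻¹ k (c ∘ suc)) j ≈ mul1+x² (substX+X⁻¹ k (d ∘ suc)) j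
    below j j≤k πj = begin
      mul1+x² (substX+X⁻¹ k (c ∘ suc)) j  ≈⟨ substX+X⁻¹-suc-below k c j≤k ⟨
      substX+X⁻¹ (suc k) c j              ≈⟨ eq j πj ⟩
      substX+X⁻¹ (suc k) d j              ≈⟨ substX+X⁻¹-suc-below k d j≤k ⟩
      mul1+x² (substX+X⁻¹ k (d ∘ suc)) j  ∎

  -- The term c_i x^{k∸i} (1 + x²)^i of substX+X⁻¹ k c only occupies positions of the parity of k ∸ i.
  substX+X⁻¹-injective : ∀ k c d π →
    (∀ j → parity j ≡ π → substX+X⁻¹ k c j ≈ substX+X⁻¹ k d j) →
    ∀ i t → i + suc t ≡ k → parity (suc t) ≡ π → c i ≈ d i
  substX+X⁻¹-injective zero c d π eq i t i+t+1≡0 _ = ⊥-elim (ℕₚ.m+1+n≢0 i i+t+1≡0)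
  substX+X⁻¹-injective (suc k) c d π eq (suc i) t e πt =
    substX+X⁻¹-injective k _ _ π (substX+X⁻¹-tail k c d π eq) i t (ℕₚ.suc-injective e) πt
  substX+X⁻¹-injective (suc k) c d π eq zero .k ≡.refl πk+1 = ∙-cancelʳ (top c) _ _ (begin
    c 0 ∙ top c                   ≡⟨ ≡.cong (_∙ top c) (monomial-diagonal (suc k) (c 0)) ⟨
    substX+X⁻¹ (suc k) c (suc k)  ≈⟨ eq (suc k) πk+1 ⟩
    substX+X⁻¹ (suc k) d (suc k)  ≈⟨ ∙-cong (reflexive (monomial-diagonal (suc k) (d 0))) (sym top-agree) ⟩
    d 0 ∙ top c                   ∎)
    where
    top : Seq → Carrier
    top e = mul1+x² (substX+X⁻¹ k (e ∘ suc)) (suc k)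
    top-agree : top c ≈ top d
    top-agree = mul1+x²-local (suc k) (λ i _ πi → substX+X⁻¹-tail k c d π eq i (≡.trans πi πk+1))

  -- For f = c₀ x^{k+1} + (1 + x²) g, below degree k + 1 the sequence g must be the power series
  -- f / (1 + x²); mirroring it about k makes it symmetric, c₀ is read off in degree k + 1, and
  -- both sides being symmetric settles the degrees above.
  substX+X⁻¹-surjective : ∀ k {f} → Symmetric k f → Σ Seq λ c → substX+X⁻¹ k c ≋ f
  substX+X⁻¹-surjective zero    (_ , Z) = (λ _ → ε) , λ j → sym (Z j z≤n)
  substX+X⁻¹-surjective (suc k) {f} Sf =
    c , symmetric-agree (suc k) (substX+X⁻¹-symmetric (suc k) c) Sf agree
    where
    h = divide1+x² f
    g = mirror (k + k) h
    IH = substX+X⁻¹-surjective k {g} (mirror-palindromic (k + k) h ,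
           mirror-vanishes (k + k) h (symmetric⇒vanishes-at-0 {suc k} Sf))
    c′ = proj₁ IH
    top = mul1+x² (substX+X⁻¹ k c′) (suc k)

    c : Seq
    c zero    = f (suc k) - top
    c (suc i) = c′ i

    agree : ∀ j → j ≤ suc k → substX+X⁻¹ (suc k) c j ≈ f j
    agree j j≤k+1 with ℕₚ.m≤n⇒m<n∨m≡n j≤k+1
    ... | inj₂ ≡.refl =
      trans (∙-congʳ (reflexive (monomial-diagonal (suc k) (c 0)))) (//-rightDividesˡ top (f (suc k)))
    ... | inj₁ (s≤s j≤k) = begin
      substX+X⁻¹ (suc k) c j       ≈⟨ substX+X⁻¹-suc-below k c j≤k ⟩
      mul1+x² (substX+X⁻¹ k c′) j  ≈⟨ mul1+x²-cong (proj₂ IH) j ⟩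
      mul1+x² g j                  ≈⟨ mul1+x²-local j g≈h ⟩
      mul1+x² h j                  ≈⟨ mul1+x²-divide1+x² f j ⟩
      f j                          ∎
      where
      g≈h : ∀ i → i ≤ j → parity i ≡ parity j → g i ≈ h i
      g≈h i i≤j _ = reflexive (mirror-below (k + k) h i (ℕₚ.+-mono-≤ i≤k i≤k))
        where i≤k = ℕₚ.≤-trans i≤j j≤k

  dilate-even : ∀ f a → dilate f (a + a) ≡ f a
  dilate-even f zero    = ≡.refl
  dilate-even f (suc a) = ≡.trans (≡.cong (dilate f) (double-suc a)) (dilate-even (f ∘ suc) a)

  dilate-ε : ∀ j → dilate (λ _ → ε) j ≡ ε
  dilate-ε zero          = ≡.refl
  dilate-ε (suc zero)    = ≡.refl
  dilate-ε (suc (suc j)) = dilate-ε j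

  dilate-odd : ∀ f j → parity j ≡ 1ℙ → dilate f j ≡ ε
  dilate-odd f (suc zero)    _  = ≡.refl
  dilate-odd f (suc (suc j)) πj = dilate-odd (f ∘ suc) j πj

  x·dilate-even : ∀ f j → parity j ≡ 0ℙ → shift 1 (dilate f) j ≡ ε
  x·dilate-even f zero    _  = ≡.refl
  x·dilate-even f (suc j) πj = dilate-odd f j (≡.trans (≡.sym (ℙₚ.suc-homo-⁻¹ j)) (≡.cong ℙ._⁻¹ πj))

  dilate-palindromic : ∀ {n f} → Palindromic n f → Palindromic (n + n) (dilate f)
  dilate-palindromic {n} {f} P j l e with halves j | halves l
  ... | even a | even b = begin
    dilate f (a + a)  ≡⟨ dilate-even f a ⟩
    f a               ≈⟨ P a b (doubles-+⁻¹ a b e) ⟩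
    f b               ≡⟨ dilate-even f b ⟨
    dilate f (b + b)  ∎
  ... | odd a  | odd b  = reflexive (≡.trans (dilate-odd f (suc (a + a)) (parity-double+1 a))
                                             (≡.sym (dilate-odd f (suc (b + b)) (parity-double+1 b))))
  ... | even a | odd b  =
    ⊥-elim (parity-double≢double+1 a b (+≡double⇒parity≡ (a + a) (suc (b + b)) n e))
  ... | odd a  | even b =
    ⊥-elim (parity-double≢double+1 b a (≡.sym (+≡double⇒parity≡ (suc (a + a)) (b + b) n e)))

  x·dilate-symmetric : ∀ {n f} → Palindromic n f → VanishesFrom (suc n) f →
                       Symmetric (suc n) (shift 1 (dilate f))
  x·dilate-symmetric {n} {f} P Z = palindromic , vanishes
    where
    palindromic : Palindromic (suc n + suc n) (shift 1 (dilate f))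
    palindromic zero    l       e =
      reflexive (≡.sym (x·dilate-even f l (≡.sym (+≡double⇒parity≡ 0 l (suc n) e))))
    palindromic (suc j) zero    e =
      reflexive (x·dilate-even f (suc j) (+≡double⇒parity≡ (suc j) 0 (suc n) e))
    palindromic (suc j) (suc l) e = dilate-palindromic P j l
      (ℕₚ.suc-injective (≡.trans (≡.sym (ℕₚ.+-suc j l)) (≡.trans (ℕₚ.suc-injective e) (ℕₚ.+-suc n n))))

    vanishes : VanishesFrom (suc n + suc n) (shift 1 (dilate f))
    vanishes (suc j) (s≤s 2n+1≤j) with halves j
    ... | even a = trans (reflexive (dilate-even f a)) (Z a (ℕₚ.≰⇒> a≰n))
      where
      a≰n : ¬ a ≤ n
      a≰n a≤n = ℕₚ.<⇒≱ (≡.subst (_≤ a + a) (ℕₚ.+-suc n n) 2n+1≤j) (ℕₚ.+-mono-≤ a≤n a≤n)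
    ... | odd a  = reflexive (dilate-odd f (suc (a + a)) (parity-double+1 a))

  x·dilate-palindromic⁻¹ : ∀ {n f} → Palindromic (suc n + suc n) (shift 1 (dilate f)) → Palindromic n f
  x·dilate-palindromic⁻¹ {n} {f} P a b a+b≡n = begin
    f a               ≡⟨ dilate-even f a ⟨
    dilate f (a + a)  ≈⟨ P (suc (a + a)) (suc (b + b)) 2a+1+2b+1≡2n+2 ⟩
    dilate f (b + b)  ≡⟨ dilate-even f b ⟩
    f b               ∎
    where
    2a+1+2b+1≡2n+2 : suc (a + a) + suc (b + b) ≡ suc n + suc n
    2a+1+2b+1≡2n+2 = ≡.trans (≡.cong suc (ℕₚ.+-suc (a + a) (b + b)))
                      (≡.trans (≡.cong (suc ∘ suc) (doubles-+ a b a+b≡n)) (≡.sym (double-suc n)))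

module Coefficients {ℓ₁ ℓ₂} (F : Field ℓ₁ ℓ₂) where
  open Field F
  open FieldPolys F
  open Sequences +-abelianGroup
  open Arithmetic using (toℕ-opposite-+; toℕ-opposite-+-suc; toℕ-opposite-fromℕ<; m%2≡1⇒parity[1+m]≡0ℙ)
  open import Relation.Binary.Reasoning.Setoid setoid

  coeff-⊕ : ∀ P Q j → coeff (P ⊕ Q) j ≈ coeff P j + coeff Q j
  coeff-⊕ []      Q       j       = sym (+-identityˡ _)
  coeff-⊕ (a ∷ P) []      j       = sym (+-identityʳ _)
  coeff-⊕ (a ∷ P) (b ∷ Q) zero    = refl
  coeff-⊕ (a ∷ P) (b ∷ Q) (suc j) = coeff-⊕ P Q j

  coeff-scale : ∀ a P j → coeff (scale a P) j ≈ a * coeff P j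
  coeff-scale a []      j       = sym (zeroʳ a)
  coeff-scale a (b ∷ P) zero    = refl
  coeff-scale a (b ∷ P) (suc j) = coeff-scale a P j

  coeff-shiftX : ∀ P j → coeff (shiftX P) j ≡ shift 1 (coeff P) j
  coeff-shiftX P zero    = ≡.refl
  coeff-shiftX P (suc j) = ≡.refl

  coeff-∷-⊗ : ∀ a P Q j → coeff ((a ∷ P) ⊗ Q) j ≈ a * coeff Q j + shift 1 (coeff (P ⊗ Q)) j
  coeff-∷-⊗ a P Q j =
    trans (coeff-⊕ (scale a Q) (shiftX (P ⊗ Q)) j)
          (+-cong (coeff-scale a Q j) (reflexive (coeff-shiftX (P ⊗ Q) j)))

  coeff-xPow-⊗ : ∀ l P j → coeff (xPow l ⊗ P) j ≈ shift l (coeff P) j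
  coeff-xPow-⊗ zero P j = begin
    coeff ((1# ∷ []) ⊗ P) j                ≈⟨ coeff-∷-⊗ 1# [] P j ⟩
    1# * coeff P j + shift 1 (coeff []) j  ≈⟨ +-cong (*-identityˡ _) (reflexive (shift-ε 1 j)) ⟩
    coeff P j + 0#                         ≈⟨ +-identityʳ _ ⟩
    coeff P j                              ∎
  coeff-xPow-⊗ (suc l) P j = begin
    coeff ((0# ∷ xPow l) ⊗ P) j                      ≈⟨ coeff-∷-⊗ 0# (xPow l) P j ⟩
    0# * coeff P j + shift 1 (coeff (xPow l ⊗ P)) j
      ≈⟨ +-cong (zeroˡ _) (shift-cong 1 (coeff-xPow-⊗ l P) j) ⟩
    0# + shift 1 (shift l (coeff P)) j               ≈⟨ +-identityˡ _ ⟩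
    shift 1 (shift l (coeff P)) j                    ≡⟨ shift-1∘shift l (coeff P) j ⟩
    shift (suc l) (coeff P) j                        ∎

  coeff-[1+x²]-⊗ : ∀ P j → coeff ((1# ∷ 0# ∷ 1# ∷ []) ⊗ P) j ≈ mul1+x² (coeff P) j
  coeff-[1+x²]-⊗ P j = begin
    coeff ((1# ∷ xPow 1) ⊗ P) j                      ≈⟨ coeff-∷-⊗ 1# (xPow 1) P j ⟩
    1# * coeff P j + shift 1 (coeff (xPow 1 ⊗ P)) j
      ≈⟨ +-cong (*-identityˡ _) (shift-cong 1 (coeff-xPow-⊗ 1 P) j) ⟩
    coeff P j + shift 1 (shift 1 (coeff P)) j
      ≡⟨ ≡.cong (coeff P j +_) (shift-1∘shift 1 (coeff P) j) ⟩
    mul1+x² (coeff P) j                              ∎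

  shift-coeff-constP : ∀ m a j → shift m (coeff (constP a)) j ≡ monomial m a j
  shift-coeff-constP zero    a zero    = ≡.refl
  shift-coeff-constP zero    a (suc j) = ≡.refl
  shift-coeff-constP (suc m) a zero    = ≡.refl
  shift-coeff-constP (suc m) a (suc j) = shift-coeff-constP m a j

  coeff-evalP-x² : ∀ P j → coeff (evalP P x²) j ≈ dilate (coeff P) j
  coeff-evalP-x² []      j = reflexive (≡.sym (dilate-ε j))
  coeff-evalP-x² (a ∷ P) j = begin
    coeff (constP a ⊕ (x² ⊗ evalP P x²)) j                ≈⟨ coeff-⊕ (constP a) (x² ⊗ evalP P x²) j ⟩
    coeff (constP a) j + coeff (x² ⊗ evalP P x²) j        ≈⟨ +-congˡ (coeff-xPow-⊗ 2 (evalP P x²) j) ⟩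
    coeff (constP a) j + shift 2 (coeff (evalP P x²)) j   ≈⟨ low-terms j ⟩
    dilate (coeff (a ∷ P)) j                              ∎
    where
    low-terms : ∀ j → coeff (constP a) j + shift 2 (coeff (evalP P x²)) j ≈ dilate (coeff (a ∷ P)) j
    low-terms zero          = +-identityʳ a
    low-terms (suc zero)    = +-identityˡ 0#
    low-terms (suc (suc j)) = trans (+-identityˡ _) (coeff-evalP-x² P j)

  length-evalL-x+x⁻¹ : ∀ Q → proj₁ (evalL Q x+x⁻¹) ≡ length Q
  length-evalL-x+x⁻¹ []      = ≡.refl
  length-evalL-x+x⁻¹ (a ∷ Q) = ≡.cong suc (length-evalL-x+x⁻¹ Q)

  coeff-evalL-x+x⁻¹ : ∀ Q j →
    coeff (proj₂ (evalL Q x+x⁻¹)) j ≈ substX+X⁻¹ (proj₁ (evalL Q x+x⁻¹)) (coeff Q) j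
  coeff-evalL-x+x⁻¹ []      j = refl
  coeff-evalL-x+x⁻¹ (a ∷ Q) j = begin
    coeff ((xPow (suc K) ⊗ constP a) ⊕ (xPow 0 ⊗ ((1# ∷ 0# ∷ 1# ∷ []) ⊗ E))) j
      ≈⟨ coeff-⊕ (xPow (suc K) ⊗ constP a) (xPow 0 ⊗ ((1# ∷ 0# ∷ 1# ∷ []) ⊗ E)) j ⟩
    coeff (xPow (suc K) ⊗ constP a) j + coeff (xPow 0 ⊗ ((1# ∷ 0# ∷ 1# ∷ []) ⊗ E)) j
      ≈⟨ +-cong (coeff-xPow-⊗ (suc K) (constP a) j) (coeff-xPow-⊗ 0 ((1# ∷ 0# ∷ 1# ∷ []) ⊗ E) j) ⟩
    shift (suc K) (coeff (constP a)) j + coeff ((1# ∷ 0# ∷ 1# ∷ []) ⊗ E) j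
      ≈⟨ +-cong (reflexive (shift-coeff-constP (suc K) a j)) (coeff-[1+x²]-⊗ E j) ⟩
    monomial (suc K) a j + mul1+x² (coeff E) j
      ≈⟨ +-congˡ (mul1+x²-cong (coeff-evalL-x+x⁻¹ Q) j) ⟩
    monomial (suc K) a j + mul1+x² (substX+X⁻¹ K (coeff Q)) j
      ∎
    where
    K = proj₁ (evalL Q x+x⁻¹)
    E = proj₂ (evalL Q x+x⁻¹)

  represents⇔ : ∀ n p q → Represents n p q ⇔
    (shift 1 (dilate (coeff (toPoly n p))) ≋ substX+X⁻¹ (suc n) (coeff (toPoly n q)))
  represents⇔ n p q = laurent (evalL (toPoly n q) x+x⁻¹)
    (≡.trans (length-evalL-x+x⁻¹ (toPoly n q)) (length-tabulate (q ∘ opposite)))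
    (coeff-evalL-x+x⁻¹ (toPoly n q))
    where
    A = evalP (toPoly n p) x²

    lhs : ∀ j → coeff (xPow (suc n) ⊗ A) j ≈ shift n (shift 1 (dilate (coeff (toPoly n p)))) j
    lhs j = begin
      coeff (xPow (suc n) ⊗ A) j                     ≈⟨ coeff-xPow-⊗ (suc n) A j ⟩
      shift (suc n) (coeff A) j                      ≈⟨ shift-cong (suc n) (coeff-evalP-x² (toPoly n p)) j ⟩
      shift (suc n) (dilate (coeff (toPoly n p))) j  ≡⟨ shift-suc n _ j ⟩
      shift n (shift 1 (dilate (coeff (toPoly n p)))) j ∎

    laurent : ∀ (L : Laurent) → proj₁ L ≡ suc n →
              (∀ j → coeff (proj₂ L) j ≈ substX+X⁻¹ (proj₁ L) (coeff (toPoly n q)) j) →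
              (fromPoly A ≈L (fromPoly (xPow n) ⊗L L)) ⇔
              (shift 1 (dilate (coeff (toPoly n p))) ≋ substX+X⁻¹ (suc n) (coeff (toPoly n q)))
    laurent (K , E) ≡.refl coeff-E = mk⇔
      (λ r → shift-cancel n (λ j → trans (sym (lhs j)) (trans (r j) (rhs j))))
      (λ eq j → trans (lhs j) (trans (shift-cong n eq j) (sym (rhs j))))
      where
      rhs : ∀ j → coeff (xPow 0 ⊗ (xPow n ⊗ E)) j ≈ shift n (substX+X⁻¹ (suc n) (coeff (toPoly n q))) j
      rhs j = trans (coeff-xPow-⊗ 0 (xPow n ⊗ E) j) (trans (coeff-xPow-⊗ n E j) (shift-cong n coeff-E j))

  coeff-tabulate : ∀ {m} (g : Fin m → Carrier) i → coeff (tabulate g) (toℕ i) ≡ g i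
  coeff-tabulate g Fin.zero    = ≡.refl
  coeff-tabulate g (Fin.suc i) = coeff-tabulate (λ k → g (Fin.suc k)) i

  coeff-tabulate-vanishes : ∀ m (g : Fin m → Carrier) → VanishesFrom m (coeff (tabulate g))
  coeff-tabulate-vanishes zero    g j       _         = refl
  coeff-tabulate-vanishes (suc m) g (suc j) (s≤s m≤j) =
    coeff-tabulate-vanishes m (λ k → g (Fin.suc k)) j m≤j

  coeff-toPoly-opposite : ∀ n (v : V n) i → coeff (toPoly n v) (toℕ (opposite i)) ≡ v i
  coeff-toPoly-opposite n v i =
    ≡.trans (coeff-tabulate (λ k → v (opposite k)) (opposite i)) (≡.cong v (Finₚ.opposite-involutive i))

  coeff-toPoly-below : ∀ n (c : ℕ → Carrier) i → i < suc n →
                       coeff (toPoly n (λ k → c (toℕ (opposite k)))) i ≈ c i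
  coeff-toPoly-below n c i i<n+1 = begin
    coeff (toPoly n q) i             ≡⟨ ≡.cong (coeff (toPoly n q)) (Finₚ.toℕ-fromℕ< i<n+1) ⟨
    coeff (toPoly n q) (toℕ j)       ≡⟨ coeff-tabulate (q ∘ opposite) j ⟩
    c (toℕ (opposite (opposite j)))  ≡⟨ ≡.cong (c ∘ toℕ) (Finₚ.opposite-involutive j) ⟩
    c (toℕ j)                        ≡⟨ ≡.cong c (Finₚ.toℕ-fromℕ< i<n+1) ⟩
    c i                              ∎
    where
    q : V n
    q k = c (toℕ (opposite k))
    j = fromℕ< i<n+1

  inW⇔palindromic : ∀ n p → InW n p ⇔ Palindromic n (coeff (toPoly n p))
  inW⇔palindromic n p = mk⇔ palindromic inW
    where
    palindromic : InW n p → Palindromic n (coeff (toPoly n p))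
    palindromic W a b a+b≡n = begin
      coeff (toPoly n p) a                    ≡⟨ ≡.cong (coeff (toPoly n p)) (Finₚ.toℕ-fromℕ< a<n+1) ⟨
      coeff (toPoly n p) (toℕ i)              ≡⟨ coeff-tabulate (λ k → p (opposite k)) i ⟩
      p (opposite i)                          ≈⟨ W i ⟨
      p i                                     ≡⟨ coeff-toPoly-opposite n p i ⟨
      coeff (toPoly n p) (toℕ (opposite i))   ≡⟨ ≡.cong (coeff (toPoly n p)) opposite-i≡b ⟩
      coeff (toPoly n p) b                    ∎
      where
      a<n+1 : a < suc n
      a<n+1 = s≤s (ℕₚ.m+n≤o⇒m≤o a (ℕₚ.≤-reflexive a+b≡n))
      i = fromℕ< a<n+1
      opposite-i≡b : toℕ (opposite i) ≡ b
      opposite-i≡b = toℕ-opposite-fromℕ< a<n+1 a+b≡n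
    inW : Palindromic n (coeff (toPoly n p)) → InW n p
    inW P i = begin
      p i                                     ≡⟨ coeff-toPoly-opposite n p i ⟨
      coeff (toPoly n p) (toℕ (opposite i))   ≈⟨ P (toℕ (opposite i)) (toℕ i) (toℕ-opposite-+ i) ⟩
      coeff (toPoly n p) (toℕ i)              ≡⟨ coeff-tabulate (λ k → p (opposite k)) i ⟩
      p (opposite i)                          ∎

  module _ (n : ℕ) (p : V n) where
    private
      x·p[x²] = shift 1 (dilate (coeff (toPoly n p)))

      coefficients-represent : ∀ q → Represents n p q → x·p[x²] ≋ substX+X⁻¹ (suc n) (coeff (toPoly n q))
      coefficients-represent q = Equivalence.to (represents⇔ n p q)

    represented⇒inW : (∃ λ q → Represents n p q) → InW n p
    represented⇒inW (q , r) = Equivalence.from (inW⇔palindromic n p) (x·dilate-palindromic⁻¹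
      (palindromic-resp-≋ (coefficients-represent q r)
        (proj₁ (substX+X⁻¹-symmetric (suc n) (coeff (toPoly n q))))))

    inW⇒represented : InW n p → ∃ λ q → Represents n p q
    inW⇒represented W = q , Equivalence.from (represents⇔ n p q) (λ j → begin
      x·p[x²] j                                  ≈⟨ proj₂ preimage j ⟨
      substX+X⁻¹ (suc n) c j                     ≈⟨ substX+X⁻¹-cong (suc n) c≈q j ⟩
      substX+X⁻¹ (suc n) (coeff (toPoly n q)) j  ∎)
      where
      preimage = substX+X⁻¹-surjective (suc n)
        (x·dilate-symmetric (Equivalence.to (inW⇔palindromic n p) W)
                            (coeff-tabulate-vanishes (suc n) (λ k → p (opposite k))))
      c = proj₁ preimage
      q : V n
      q i = c (toℕ (opposite i))
      c≈q : ∀ i → i < suc n → c i ≈ coeff (toPoly n q) i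
      c≈q i i<n+1 = sym (coeff-toPoly-below n c i i<n+1)

    represented-unique : ∀ q q′ → Represents n p q → Represents n p q′ → ∀ i → q i ≈ q′ i
    represented-unique q q′ r r′ i = begin
      q i                          ≡⟨ coeff-toPoly-opposite n q i ⟨
      cq (toℕ (opposite i))        ≈⟨ substX+X⁻¹-injective (suc n) cq cq′ (parity (suc (toℕ i))) agree
                                        (toℕ (opposite i)) (toℕ i) (toℕ-opposite-+-suc i) ≡.refl ⟩
      cq′ (toℕ (opposite i))       ≡⟨ coeff-toPoly-opposite n q′ i ⟩
      q′ i                         ∎
      where
      cq = coeff (toPoly n q)
      cq′ = coeff (toPoly n q′)
      agree : ∀ j → parity j ≡ parity (suc (toℕ i)) → substX+X⁻¹ (suc n) cq j ≈ substX+X⁻¹ (suc n) cq′ j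
      agree j _ = trans (sym (coefficients-represent q r j)) (coefficients-represent q′ r′ j)

    represented⇒inU : ∀ q → Represents n p q → InU n q
    represented⇒inU q r i i-odd = begin
      q i                    ≡⟨ coeff-toPoly-opposite n q i ⟨
      cq (toℕ (opposite i))  ≈⟨ substX+X⁻¹-injective (suc n) cq (λ _ → 0#) 0ℙ vanish-even
                                  (toℕ (opposite i)) (toℕ i) (toℕ-opposite-+-suc i)
                                  (m%2≡1⇒parity[1+m]≡0ℙ (toℕ i) i-odd) ⟩
      0#                     ∎
      where
      cq = coeff (toPoly n q)
      vanish-even : ∀ j → parity j ≡ 0ℙ → substX+X⁻¹ (suc n) cq j ≈ substX+X⁻¹ (suc n) (λ _ → 0#) j
      vanish-even j j-even = begin
        substX+X⁻¹ (suc n) cq j          ≈⟨ coefficients-represent q r j ⟨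
        x·p[x²] j                        ≡⟨ x·dilate-even (coeff (toPoly n p)) j j-even ⟩
        0#                               ≈⟨ substX+X⁻¹-ε (suc n) j ⟨
        substX+X⁻¹ (suc n) (λ _ → 0#) j  ∎

proposition2p7 : ∀ {c ℓ : Level} (F : Field c ℓ) (n : ℕ) (p : FieldPolys.V F n) →
    let open FieldPolys F
        open Field F
    in ((∃ λ q → Represents n p q) ⇔ InW n p)
       × (InW n p →
            (∀ q q′ → Represents n p q → Represents n p q′ → ∀ i → q i ≈ q′ i)
            × (∀ q → Represents n p q → InU n q))
proposition2p7 F n p =
  mk⇔ (represented⇒inW n p) (inW⇒represented n p) ,
  λ _ → represented-unique n p , represented⇒inU n p
  where open Coefficients F
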